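{- Let $E$ be an $n\times n$ bistochastic matrix which is RCDS and is written as $E_{i,j}=(u_i+v_j)\,\operatorname{skel}(E)_{i,j}$ for all $1\leq i,j\leq n$, for some vectors $u,v\in\mathbb{Q}^n$. Then $E$ is an Erdős matrix if and only if for every permutation matrix $\sigma\in P_n\setminus P_n(E)$ one has $$\sum_{\substack{1\leq i,j\leq n\\ \sigma_{i,j}=1,\ E_{i,j}=0}}(u_i+v_j)\geq 0.$$
   Context: A real $n\times n$ matrix is bistochastic if all entries lie in $[0,1]$ and every row and column sum equals $1$. $P_n$ is the set of $n\times n$ permutation matrices; for $\sigma\in P_n$ (with $\sigma_{i,j}=1$ iff $j=\sigma(i)$), $\operatorname{tr}_\sigma(M)=\operatorname{tr}(\sigma^TM)=\sum_i M_{i,\sigma(i)}$, and $\operatorname{maxtrace}(M)=\max_{\sigma\in P_n}\operatorname{tr}_\sigma(M)$. A bistochastic $E$ is Erdős if $\operatorname{maxtrace}(E)=\sum_{i,j}E_{i,j}^2$. The skeleton $\operatorname{skel}(M)$ is the $0/1$ matrix with entry $1$ exactly where $M$ is nonzero. $P_n(E)$ is the set of $\sigma\in P_n$ such that $E_{i,j}\neq0$ whenever $\sigma_{i,j}=1$ (inner permutations). A matrix $M$ is RCDS (restricted common diagonal sum) if $\operatorname{tr}_\sigma(M)$ takes the same value for all $\sigma\in P_n(M)$. -}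

module Defs where

open import Data.Nat using (ℕ; zero; suc)
open import Data.Fin using (Fin; zero; suc)
open import Data.Fin.Permutation using (Permutation′; _⟨$⟩ʳ_)
open import Data.Rational using (ℚ; 0ℚ; 1ℚ; _+_; _*_; _≤_; _≟_)
open import Data.Bool using (if_then_else_)
open import Data.Product using (_×_; ∃)
open import Relation.Nullary using (¬_; does)
open import Relation.Binary.PropositionalEquality using (_≡_; _≢_)

Matrix : ℕ → Set
Matrix n = Fin n → Fin n → ℚ

Vector : ℕ → Set
Vector n = Fin n → ℚ

Σ[<_]_ : (n : ℕ) → (Fin n → ℚ) → ℚ
Σ[< zero ] f = 0ℚ
Σ[< suc n ] f = f zero + Σ[< n ] (λ i → f (suc i))

Bistochastic : {n : ℕ} → Matrix n → Set
Bistochastic {n} M =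
  (∀ i j → (0ℚ ≤ M i j) × (M i j ≤ 1ℚ)) ×
  (∀ i → Σ[< n ] (λ j → M i j) ≡ 1ℚ) ×
  (∀ j → Σ[< n ] (λ i → M i j) ≡ 1ℚ)

tr : {n : ℕ} → Permutation′ n → Matrix n → ℚ
tr {n} σ M = Σ[< n ] (λ i → M i (σ ⟨$⟩ʳ i))

IsMaxtrace : {n : ℕ} → Matrix n → ℚ → Set
IsMaxtrace {n} M m = (∃ λ (σ : Permutation′ n) → tr σ M ≡ m) × (∀ (σ : Permutation′ n) → tr σ M ≤ m)

Erdos : {n : ℕ} → Matrix n → Set
Erdos {n} E = IsMaxtrace E (Σ[< n ] (λ i → Σ[< n ] (λ j → E i j * E i j)))

skel : {n : ℕ} → Matrix n → Matrix n
skel M i j = if does (M i j ≟ 0ℚ) then 0ℚ else 1ℚ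

Inner : {n : ℕ} → Matrix n → Permutation′ n → Set
Inner M σ = ∀ i → M i (σ ⟨$⟩ʳ i) ≢ 0ℚ

RCDS : {n : ℕ} → Matrix n → Set
RCDS M = ∀ σ τ → Inner M σ → Inner M τ → tr σ M ≡ tr τ M

outerSum : {n : ℕ} → Matrix n → Vector n → Vector n → Permutation′ n → ℚ
outerSum {n} E u v σ =
  Σ[< n ] (λ i → if does (E i (σ ⟨$⟩ʳ i) ≟ 0ℚ) then u i + v (σ ⟨$⟩ʳ i) else 0ℚ)

-- For every permutation σ the representation E i j = (u i + v j) · skel E i j gives
-- tr σ E + outerSum σ = Σ_i (u i + v (σ i)) = Σ u + Σ v, and the unit row and column sums
-- give Σ_ij E i j ² = Σ_ij E i j · (u i + v j) = Σ u + Σ v as well.  So tr σ E is at most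
-- Σ_ij E i j ² exactly when the outer sum of σ is nonnegative, with equality for inner σ.
-- That the maximum is attained needs an inner permutation: the support of a bistochastic
-- matrix satisfies Hall's condition, since ∣S∣ = Σ_{i ∈ S} Σ_j E i j ≤ ∣Γ(S)∣, and Hall's
-- theorem is proved by Rado's edge-deletion argument.

module Submission where

open import Defs
open import Data.Nat as ℕ using (ℕ; zero; suc)
import Data.Nat.Properties as ℕ
open import Data.Fin using (Fin; zero; suc; punchOut)
import Data.Fin.Properties as Fin
open import Data.Fin.Permutation using (Permutation′; _⟨$⟩ʳ_; permutation)
open import Data.Fin.Subset using (Subset; inside; outside; _∈_; ∣_∣)
open import Data.Fin.Subset.Properties using (_∈?_)
open import Data.Product using (Σ; ∃; ∃₂; _×_; _,_; proj₁; proj₂)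
open import Data.Sum using (_⊎_; inj₁; inj₂)
open import Function.Base using (_∘_)
open import Function.Bundles using (_⇔_; mk⇔; Equivalence)
open import Function.Definitions using (Injective)
open import Relation.Binary.PropositionalEquality
open import Relation.Nullary using (¬_; yes; no; does; ¬?; contradiction; decidable-stable; _×-dec_)
open import Relation.Nullary.Decidable using (dec-false)

module Hall where

  open import Data.Nat using (_+_; _≤_; _<_; _<?_; s≤s)
  open import Data.Nat.Induction using (<-wellFounded)
  open import Data.Fin.Properties using (_≟_; any?)
  open import Data.Fin.Subset using (_∉_; _⊆_; _∪_; _∩_; _-_; ⁅_⁆; ⊥; Nonempty)
  open import Data.Fin.Subset.Properties
    using ( nonempty?; ∉⊥; Empty-unique; ∣⊥∣≡0; ∣⁅x⁆∣≡1; x∈⁅x⁆; x∈⁅y⁆⇒x≡y; x≢y⇒x∉⁅y⁆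
          ; p⊆q⇒∣p∣≤∣q∣; p⊂q⇒∣p∣<∣q∣; x∈p∪q⁺; x∈p∪q⁻; x∈p∩q⁺; x∈p∩q⁻; p─q⊆p
          ; x∈p∧x≢y⇒x∈p-y; x∈p⇒∣p-x∣<∣p∣; anySubset?)
  open import Data.Vec.Base using ([]; _∷_; here; there)
  open import Data.Vec.Functional using (updateAt)
  open import Data.Vec.Functional.Properties using (updateAt-updates; updateAt-minimal)
  open import Induction.WellFounded using (module All)
  import Relation.Binary.Construct.On as On

  private
    variable
      m k : ℕ

  ∣p∪q∣+∣p∩q∣≡∣p∣+∣q∣ : ∀ (p q : Subset k) → ∣ p ∪ q ∣ + ∣ p ∩ q ∣ ≡ ∣ p ∣ + ∣ q ∣
  ∣p∪q∣+∣p∩q∣≡∣p∣+∣q∣ []            []            = refl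
  ∣p∪q∣+∣p∩q∣≡∣p∣+∣q∣ (inside  ∷ p) (inside  ∷ q) = cong suc (begin
    ∣ p ∪ q ∣ + suc ∣ p ∩ q ∣  ≡⟨ ℕ.+-suc _ _ ⟩
    suc (∣ p ∪ q ∣ + ∣ p ∩ q ∣) ≡⟨ cong suc (∣p∪q∣+∣p∩q∣≡∣p∣+∣q∣ p q) ⟩
    suc (∣ p ∣ + ∣ q ∣)         ≡⟨ ℕ.+-suc _ _ ⟨
    ∣ p ∣ + suc ∣ q ∣           ∎)
    where open ≡-Reasoning
  ∣p∪q∣+∣p∩q∣≡∣p∣+∣q∣ (inside  ∷ p) (outside ∷ q) = cong suc (∣p∪q∣+∣p∩q∣≡∣p∣+∣q∣ p q)
  ∣p∪q∣+∣p∩q∣≡∣p∣+∣q∣ (outside ∷ p) (inside  ∷ q) =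
    trans (cong suc (∣p∪q∣+∣p∩q∣≡∣p∣+∣q∣ p q)) (sym (ℕ.+-suc _ _))
  ∣p∪q∣+∣p∩q∣≡∣p∣+∣q∣ (outside ∷ p) (outside ∷ q) = ∣p∪q∣+∣p∩q∣≡∣p∣+∣q∣ p q

  ∣p∪q∣≤∣p∣+∣q∣ : ∀ (p q : Subset k) → ∣ p ∪ q ∣ ≤ ∣ p ∣ + ∣ q ∣
  ∣p∪q∣≤∣p∣+∣q∣ p q = subst (∣ p ∪ q ∣ ≤_) (∣p∪q∣+∣p∩q∣≡∣p∣+∣q∣ p q) (ℕ.m≤m+n _ _)

  ∣p∣≤1+∣p-x∣ : ∀ (p : Subset k) x → ∣ p ∣ ≤ suc ∣ p - x ∣
  ∣p∣≤1+∣p-x∣ p x = begin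
    ∣ p ∣                 ≤⟨ p⊆q⇒∣p∣≤∣q∣ p⊆⁅x⁆∪p-x ⟩
    ∣ ⁅ x ⁆ ∪ (p - x) ∣   ≤⟨ ∣p∪q∣≤∣p∣+∣q∣ ⁅ x ⁆ (p - x) ⟩
    ∣ ⁅ x ⁆ ∣ + ∣ p - x ∣ ≡⟨ cong (_+ ∣ p - x ∣) (∣⁅x⁆∣≡1 x) ⟩
    suc ∣ p - x ∣         ∎
    where
    open ℕ.≤-Reasoning
    p⊆⁅x⁆∪p-x : p ⊆ ⁅ x ⁆ ∪ (p - x)
    p⊆⁅x⁆∪p-x {y} y∈p with y ≟ x
    ... | yes refl = x∈p∪q⁺ (inj₁ (x∈⁅x⁆ x))
    ... | no  y≢x  = x∈p∪q⁺ (inj₂ (x∈p∧x≢y⇒x∈p-y y∈p y≢x))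

  x∉p-x : ∀ (p : Subset k) x → x ∉ p - x
  x∉p-x (s ∷ p) zero    ()
  x∉p-x (s ∷ p) (suc x) (there x∈p-x) = x∉p-x p x x∈p-x

  x∈p∧y∈p∧x≢y⇒2≤∣p∣ : ∀ {p : Subset k} {x y} → x ∈ p → y ∈ p → x ≢ y → 2 ≤ ∣ p ∣
  x∈p∧y∈p∧x≢y⇒2≤∣p∣ {p = p} {x} {y} x∈p y∈p x≢y =
    subst (_< ∣ p ∣) (∣⁅x⁆∣≡1 x) (p⊂q⇒∣p∣<∣q∣ (⁅x⁆⊆p , y , y∈p , x≢y⇒x∉⁅y⁆ (x≢y ∘ sym)))
    where
    ⁅x⁆⊆p : ⁅ x ⁆ ⊆ p
    ⁅x⁆⊆p z∈⁅x⁆ = subst (_∈ p) (sym (x∈⁅y⁆⇒x≡y x z∈⁅x⁆)) x∈p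

  1≤∣p∣⇒nonempty : ∀ {p : Subset k} → 1 ≤ ∣ p ∣ → Nonempty p
  1≤∣p∣⇒nonempty {k} {p} 1≤∣p∣ with nonempty? p
  ... | yes p≢∅ = p≢∅
  ... | no  p≡∅ = contradiction (trans (cong ∣_∣ (Empty-unique p≡∅)) (∣⊥∣≡0 k)) (ℕ.>⇒≢ 1≤∣p∣)

  Graph : ℕ → ℕ → Set
  Graph m k = Fin m → Subset k

  Γ : Graph m k → Subset m → Subset k
  Γ R []            = ⊥
  Γ R (inside  ∷ S) = R zero ∪ Γ (R ∘ suc) S
  Γ R (outside ∷ S) = Γ (R ∘ suc) S

  Γ⁺ : ∀ (R : Graph m k) {S x y} → x ∈ S → y ∈ R x → y ∈ Γ R S
  Γ⁺ R {inside  ∷ S} here       y∈Rx = x∈p∪q⁺ (inj₁ y∈Rx)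
  Γ⁺ R {inside  ∷ S} (there x∈S) y∈Rx = x∈p∪q⁺ (inj₂ (Γ⁺ (R ∘ suc) x∈S y∈Rx))
  Γ⁺ R {outside ∷ S} (there x∈S) y∈Rx = Γ⁺ (R ∘ suc) x∈S y∈Rx

  Γ⁻ : ∀ (R : Graph m k) S {y} → y ∈ Γ R S → ∃ λ x → x ∈ S × y ∈ R x
  Γ⁻ R []            y∈⊥ = contradiction y∈⊥ ∉⊥
  Γ⁻ R (inside  ∷ S) y∈Γ with x∈p∪q⁻ (R zero) _ y∈Γ
  ... | inj₁ y∈R0 = zero , here , y∈R0
  ... | inj₂ y∈ΓS with Γ⁻ (R ∘ suc) S y∈ΓS
  ...   | x , x∈S , y∈Rx = suc x , there x∈S , y∈Rx
  Γ⁻ R (outside ∷ S) y∈Γ with Γ⁻ (R ∘ suc) S y∈Γ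
  ... | x , x∈S , y∈Rx = suc x , there x∈S , y∈Rx

  HallCondition : Graph m k → Set
  HallCondition R = ∀ S → ∣ S ∣ ≤ ∣ Γ R S ∣

  Deficient : Graph m k → Subset m → Set
  Deficient R S = ∣ Γ R S ∣ < ∣ S ∣

  hallCondition⊎deficient : (R : Graph m k) → HallCondition R ⊎ ∃ (Deficient R)
  hallCondition⊎deficient R with anySubset? (λ S → ∣ Γ R S ∣ <? ∣ S ∣)
  ... | yes deficient = inj₂ deficient
  ... | no  ¬deficient = inj₁ (λ S → ℕ.≮⇒≥ (λ ΓS<S → ¬deficient (S , ΓS<S)))

  Matching : Graph m k → Set
  Matching {m} {k} R = Σ (Fin m → Fin k) λ f → Injective _≡_ _≡_ f × (∀ x → f x ∈ R x)

  matching-mono : ∀ {R R′ : Graph m k} → (∀ x → R x ⊆ R′ x) → Matching R → Matching R′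
  matching-mono R⊆R′ (f , f-inj , f∈R) = f , f-inj , λ x → R⊆R′ x (f∈R x)

  removeEdge : Graph m k → Fin m → Fin k → Graph m k
  removeEdge R x y = updateAt R x (_- y)

  removeEdge-⊆ : ∀ (R : Graph m k) x y i → removeEdge R x y i ⊆ R i
  removeEdge-⊆ R x y i with i ≟ x
  ... | yes refl = subst (_⊆ R x) (sym (updateAt-updates x R)) (p─q⊆p (R x) ⁅ y ⁆)
  ... | no  i≢x  = subst (_⊆ R i) (sym (updateAt-minimal i x R i≢x)) (λ z∈Ri → z∈Ri)

  removeEdge-otherRow : ∀ (R : Graph m k) {x y i z} → i ≢ x → z ∈ R i → z ∈ removeEdge R x y i
  removeEdge-otherRow R {x} {i = i} i≢x = subst (_ ∈_) (sym (updateAt-minimal i x R i≢x))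

  removeEdge-otherColumn : ∀ (R : Graph m k) {x y i z} → z ≢ y → z ∈ R i → z ∈ removeEdge R x y i
  removeEdge-otherColumn R {x} {y} {i} z≢y z∈Ri with i ≟ x
  ... | yes refl = subst (_ ∈_) (sym (updateAt-updates x R)) (x∈p∧x≢y⇒x∈p-y z∈Ri z≢y)
  ... | no  i≢x  = removeEdge-otherRow R i≢x z∈Ri

  edges : Graph m k → ℕ
  edges {zero}  R = 0
  edges {suc m} R = ∣ R zero ∣ + edges (R ∘ suc)

  edges-removeEdge : ∀ (R : Graph m k) {x y} → y ∈ R x → edges (removeEdge R x y) < edges R
  edges-removeEdge R {zero}  y∈Rx = ℕ.+-monoˡ-< (edges (R ∘ suc)) (x∈p⇒∣p-x∣<∣p∣ y∈Rx)
  edges-removeEdge R {suc x} y∈Rx = ℕ.+-monoʳ-< ∣ R zero ∣ (edges-removeEdge (R ∘ suc) y∈Rx)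

  deficient-removeEdge⇒∈ : ∀ (R : Graph m k) {x y S} → HallCondition R →
                            Deficient (removeEdge R x y) S → x ∈ S
  deficient-removeEdge⇒∈ R {x} {y} {S} hallR deficient with x ∈? S
  ... | yes x∈S = x∈S
  ... | no  x∉S = contradiction (ℕ.≤-trans (hallR S) (p⊆q⇒∣p∣≤∣q∣ ΓS⊆Γ′S)) (ℕ.<⇒≱ deficient)
    where
    ΓS⊆Γ′S : Γ R S ⊆ Γ (removeEdge R x y) S
    ΓS⊆Γ′S z∈ΓS with Γ⁻ R S z∈ΓS
    ... | i , i∈S , z∈Ri = Γ⁺ _ i∈S (removeEdge-otherRow R (λ { refl → x∉S i∈S }) z∈Ri)

  -- Rado: deficient sets S₁, S₂ for the two deletions both contain x, and then S₁ ∪ S₂ and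
  -- (S₁ ∩ S₂) - x together have too few neighbours in R.
  removeEdge-preserves-hallCondition :
    ∀ (R : Graph m k) {x y₁ y₂} → HallCondition R → y₁ ≢ y₂ →
    HallCondition (removeEdge R x y₁) ⊎ HallCondition (removeEdge R x y₂)
  removeEdge-preserves-hallCondition R {x} {y₁} {y₂} hallR y₁≢y₂
    with hallCondition⊎deficient (removeEdge R x y₁) | hallCondition⊎deficient (removeEdge R x y₂)
  ... | inj₁ hall₁ | _         = inj₁ hall₁
  ... | inj₂ _     | inj₁ hall₂ = inj₂ hall₂
  ... | inj₂ (S₁ , deficient₁) | inj₂ (S₂ , deficient₂) = contradiction counting (ℕ.<⇒≱ deficient₁+₂)
    where
    R₁ R₂ : Graph _ _
    R₁ = removeEdge R x y₁
    R₂ = removeEdge R x y₂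
    T₁ T₂ : Subset _
    T₁ = Γ R₁ S₁
    T₂ = Γ R₂ S₂
    x∈S₁ : x ∈ S₁
    x∈S₁ = deficient-removeEdge⇒∈ R hallR deficient₁
    x∈S₂ : x ∈ S₂
    x∈S₂ = deficient-removeEdge⇒∈ R hallR deficient₂

    Γ∪⊆ : Γ R (S₁ ∪ S₂) ⊆ T₁ ∪ T₂
    Γ∪⊆ {z} z∈Γ with Γ⁻ R (S₁ ∪ S₂) z∈Γ
    ... | i , i∈S₁∪S₂ , z∈Ri with i ≟ x | x∈p∪q⁻ S₁ S₂ i∈S₁∪S₂ | z ≟ y₁
    ... | no i≢x | inj₁ i∈S₁ | _ = x∈p∪q⁺ (inj₁ (Γ⁺ R₁ i∈S₁ (removeEdge-otherRow R i≢x z∈Ri)))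
    ... | no i≢x | inj₂ i∈S₂ | _ = x∈p∪q⁺ (inj₂ (Γ⁺ R₂ i∈S₂ (removeEdge-otherRow R i≢x z∈Ri)))
    ... | yes refl | _ | no z≢y₁ = x∈p∪q⁺ (inj₁ (Γ⁺ R₁ x∈S₁ (removeEdge-otherColumn R z≢y₁ z∈Ri)))
    ... | yes refl | _ | yes refl = x∈p∪q⁺ (inj₂ (Γ⁺ R₂ x∈S₂ (removeEdge-otherColumn R y₁≢y₂ z∈Ri)))

    Γ∩⊆ : Γ R ((S₁ ∩ S₂) - x) ⊆ T₁ ∩ T₂
    Γ∩⊆ z∈Γ with Γ⁻ R ((S₁ ∩ S₂) - x) z∈Γ
    ... | i , i∈S₁∩S₂-x , z∈Ri with x∈p∩q⁻ S₁ S₂ (p─q⊆p _ _ i∈S₁∩S₂-x)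
    ...   | i∈S₁ , i∈S₂ = x∈p∩q⁺ ( Γ⁺ R₁ i∈S₁ (removeEdge-otherRow R i≢x z∈Ri)
                                 , Γ⁺ R₂ i∈S₂ (removeEdge-otherRow R i≢x z∈Ri))
      where
      i≢x : i ≢ x
      i≢x refl = x∉p-x (S₁ ∩ S₂) x i∈S₁∩S₂-x

    counting : ∣ S₁ ∣ + ∣ S₂ ∣ ≤ suc (∣ T₁ ∣ + ∣ T₂ ∣)
    counting = begin
      ∣ S₁ ∣ + ∣ S₂ ∣                               ≡⟨ ∣p∪q∣+∣p∩q∣≡∣p∣+∣q∣ S₁ S₂ ⟨
      ∣ S₁ ∪ S₂ ∣ + ∣ S₁ ∩ S₂ ∣                     ≤⟨ ℕ.+-monoʳ-≤ ∣ S₁ ∪ S₂ ∣ (∣p∣≤1+∣p-x∣ (S₁ ∩ S₂) x) ⟩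
      ∣ S₁ ∪ S₂ ∣ + suc ∣ (S₁ ∩ S₂) - x ∣           ≤⟨ ℕ.+-mono-≤ (hallR (S₁ ∪ S₂)) (s≤s (hallR ((S₁ ∩ S₂) - x))) ⟩
      ∣ Γ R (S₁ ∪ S₂) ∣ + suc ∣ Γ R ((S₁ ∩ S₂) - x) ∣ ≤⟨ ℕ.+-mono-≤ (p⊆q⇒∣p∣≤∣q∣ Γ∪⊆) (s≤s (p⊆q⇒∣p∣≤∣q∣ Γ∩⊆)) ⟩
      ∣ T₁ ∪ T₂ ∣ + suc ∣ T₁ ∩ T₂ ∣                 ≡⟨ ℕ.+-suc _ _ ⟩
      suc (∣ T₁ ∪ T₂ ∣ + ∣ T₁ ∩ T₂ ∣)               ≡⟨ cong suc (∣p∪q∣+∣p∩q∣≡∣p∣+∣q∣ T₁ T₂) ⟩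
      suc (∣ T₁ ∣ + ∣ T₂ ∣)                         ∎
      where open ℕ.≤-Reasoning

    deficient₁+₂ : suc (∣ T₁ ∣ + ∣ T₂ ∣) < ∣ S₁ ∣ + ∣ S₂ ∣
    deficient₁+₂ = ℕ.≤-trans (s≤s (ℕ.≤-reflexive (sym (ℕ.+-suc _ _)))) (ℕ.+-mono-≤ deficient₁ deficient₂)

  Γ⁅x⁆⊆R : ∀ (R : Graph m k) x → Γ R ⁅ x ⁆ ⊆ R x
  Γ⁅x⁆⊆R R x y∈Γ with Γ⁻ R ⁅ x ⁆ y∈Γ
  ... | i , i∈⁅x⁆ , y∈Ri = subst (λ j → _ ∈ R j) (x∈⁅y⁆⇒x≡y x i∈⁅x⁆) y∈Ri

  hallCondition⇒neighbour : ∀ (R : Graph m k) → HallCondition R → ∀ x → Nonempty (R x)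
  hallCondition⇒neighbour R hallR x = 1≤∣p∣⇒nonempty (begin
    1                ≡⟨ ∣⁅x⁆∣≡1 x ⟨
    ∣ ⁅ x ⁆ ∣         ≤⟨ hallR ⁅ x ⁆ ⟩
    ∣ Γ R ⁅ x ⁆ ∣     ≤⟨ p⊆q⇒∣p∣≤∣q∣ (Γ⁅x⁆⊆R R x) ⟩
    ∣ R x ∣           ∎)
    where open ℕ.≤-Reasoning

  AtMostOneNeighbour : Graph m k → Set
  AtMostOneNeighbour R = ∀ x {y₁ y₂} → y₁ ∈ R x → y₂ ∈ R x → y₁ ≡ y₂

  hall-atMostOneNeighbour : ∀ (R : Graph m k) → HallCondition R → AtMostOneNeighbour R → Matching R
  hall-atMostOneNeighbour R hallR unique = f , f-injective , f∈R
    where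
    f : Fin _ → Fin _
    f x = proj₁ (hallCondition⇒neighbour R hallR x)
    f∈R : ∀ x → f x ∈ R x
    f∈R x = proj₂ (hallCondition⇒neighbour R hallR x)

    f-injective : Injective _≡_ _≡_ f
    f-injective {a} {b} fa≡fb with a ≟ b
    ... | yes a≡b = a≡b
    ... | no  a≢b = contradiction (ℕ.≤-trans 2≤∣S∣ (ℕ.≤-trans (hallR S) ∣ΓS∣≤1)) ℕ.1+n≰n
      where
      S : Subset _
      S = ⁅ a ⁆ ∪ ⁅ b ⁆
      2≤∣S∣ : 2 ≤ ∣ S ∣
      2≤∣S∣ = x∈p∧y∈p∧x≢y⇒2≤∣p∣ (x∈p∪q⁺ (inj₁ (x∈⁅x⁆ a))) (x∈p∪q⁺ (inj₂ (x∈⁅x⁆ b))) a≢b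
      ΓS⊆⁅fa⁆ : Γ R S ⊆ ⁅ f a ⁆
      ΓS⊆⁅fa⁆ z∈ΓS with Γ⁻ R S z∈ΓS
      ... | i , i∈S , z∈Ri with x∈p∪q⁻ ⁅ a ⁆ ⁅ b ⁆ i∈S
      ...   | inj₁ i∈⁅a⁆ rewrite x∈⁅y⁆⇒x≡y a i∈⁅a⁆ =
        subst (_∈ ⁅ f a ⁆) (unique a (f∈R a) z∈Ri) (x∈⁅x⁆ (f a))
      ...   | inj₂ i∈⁅b⁆ rewrite x∈⁅y⁆⇒x≡y b i∈⁅b⁆ =
        subst (_∈ ⁅ f a ⁆) (trans fa≡fb (unique b (f∈R b) z∈Ri)) (x∈⁅x⁆ (f a))
      ∣ΓS∣≤1 : ∣ Γ R S ∣ ≤ 1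
      ∣ΓS∣≤1 = subst (∣ Γ R S ∣ ≤_) (∣⁅x⁆∣≡1 (f a)) (p⊆q⇒∣p∣≤∣q∣ ΓS⊆⁅fa⁆)

  TwoNeighbours : Graph m k → Fin m → Set
  TwoNeighbours R x = ∃₂ λ y₁ y₂ → y₁ ≢ y₂ × y₁ ∈ R x × y₂ ∈ R x

  atMostOneNeighbour⊎twoNeighbours : ∀ (R : Graph m k) → AtMostOneNeighbour R ⊎ ∃ (TwoNeighbours R)
  atMostOneNeighbour⊎twoNeighbours R
    with any? (λ x → any? (λ y₁ → any? (λ y₂ → ¬? (y₁ ≟ y₂) ×-dec y₁ ∈? R x ×-dec y₂ ∈? R x)))
  ... | yes two = inj₂ two
  ... | no ¬two = inj₁ λ x {y₁} {y₂} y₁∈Rx y₂∈Rx →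
    decidable-stable (y₁ ≟ y₂) (λ y₁≢y₂ → ¬two (x , y₁ , y₂ , y₁≢y₂ , y₁∈Rx , y₂∈Rx))

  hall : ∀ (R : Graph m k) → HallCondition R → Matching R
  hall = All.wfRec (On.wellFounded edges <-wellFounded) _ (λ R → HallCondition R → Matching R) step
    where
    step : ∀ R → (∀ {R′} → edges R′ < edges R → HallCondition R′ → Matching R′) →
           HallCondition R → Matching R
    step R rec hallR with atMostOneNeighbour⊎twoNeighbours R
    ... | inj₁ unique = hall-atMostOneNeighbour R hallR unique
    ... | inj₂ (x , y₁ , y₂ , y₁≢y₂ , y₁∈Rx , y₂∈Rx) with removeEdge-preserves-hallCondition R hallR y₁≢y₂
    ...   | inj₁ hall₁ = matching-mono (removeEdge-⊆ R x y₁) (rec (edges-removeEdge R y₁∈Rx) hall₁)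
    ...   | inj₂ hall₂ = matching-mono (removeEdge-⊆ R x y₂) (rec (edges-removeEdge R y₂∈Rx) hall₂)

open Hall

open import Algebra.Bundles using (CommutativeRing)
import Algebra.Properties.Semiring.Sum as SemiringSum
open import Data.Bool using (not; if_then_else_)
open import Data.Rational using (ℚ; 0ℚ; 1ℚ; _+_; _*_; _≤_; _<_; _≟_)
import Data.Rational.Properties as ℚ
open import Data.Vec.Base using ([]; _∷_; tabulate)
open import Data.Vec.Properties using (lookup∘tabulate; lookup⇒[]=; []=⇒lookup)

private
  variable
    n : ℕ

-- A missed value y could be punched out, giving an injection Fin (suc n) → Fin n.
injective⇒surjective : ∀ {f : Fin n → Fin n} → Injective _≡_ _≡_ f → ∀ y → ∃ λ x → f x ≡ y
injective⇒surjective {n} {f} f-injective y with Fin.any? (λ x → f x Fin.≟ y)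
... | yes y∈image = y∈image
injective⇒surjective {suc n} {f} f-injective y | no y∉image =
  let i , j , i<j , fi≡fj = Fin.pigeonhole (ℕ.n<1+n n) (λ x → punchOut (y≢f x))
  in  contradiction (f-injective (Fin.punchOut-injective (y≢f i) (y≢f j) fi≡fj)) (Fin.<⇒≢ i<j)
  where
  y≢f : ∀ x → y ≢ f x
  y≢f x y≡fx = y∉image (x , sym y≡fx)

injective⇒permutation : ∀ {f : Fin n → Fin n} → Injective _≡_ _≡_ f → Permutation′ n
injective⇒permutation {f = f} f-injective = permutation f (proj₁ ∘ f⁻¹)
  (proj₂ ∘ f⁻¹) (λ x → f-injective (proj₂ (f⁻¹ (f x))))
  where
  f⁻¹ : ∀ y → ∃ λ x → f x ≡ y
  f⁻¹ = injective⇒surjective f-injective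

module ℚ-Sum = SemiringSum (CommutativeRing.semiring ℚ.+-*-commutativeRing)
open ℚ-Sum using (sum)

Σ≡sum : ∀ (f : Fin n → ℚ) → Σ[< n ] f ≡ sum f
Σ≡sum {zero}  f = refl
Σ≡sum {suc n} f = cong (f zero +_) (Σ≡sum (f ∘ suc))

Σ-cong : ∀ {f g : Fin n → ℚ} → (∀ i → f i ≡ g i) → Σ[< n ] f ≡ Σ[< n ] g
Σ-cong {n} {f} {g} f≗g = trans (Σ≡sum f) (trans (ℚ-Sum.sum-cong-≗ f≗g) (sym (Σ≡sum g)))

Σ-mono-≤ : ∀ {f g : Fin n → ℚ} → (∀ i → f i ≤ g i) → Σ[< n ] f ≤ Σ[< n ] g
Σ-mono-≤ {zero}  f≤g = ℚ.≤-refl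
Σ-mono-≤ {suc n} f≤g = ℚ.+-mono-≤ (f≤g zero) (Σ-mono-≤ (f≤g ∘ suc))

Σ-zero : ∀ {f : Fin n → ℚ} → (∀ i → f i ≡ 0ℚ) → Σ[< n ] f ≡ 0ℚ
Σ-zero {zero}  f≗0 = refl
Σ-zero {suc n} f≗0 = trans (cong₂ _+_ (f≗0 zero) (Σ-zero (f≗0 ∘ suc))) (ℚ.+-identityˡ 0ℚ)

Σ-distrib-+ : ∀ (f g : Fin n → ℚ) → Σ[< n ] (λ i → f i + g i) ≡ Σ[< n ] f + Σ[< n ] g
Σ-distrib-+ {n} f g =
  trans (Σ≡sum {n} _) (trans (ℚ-Sum.∑-distrib-+ f g) (sym (cong₂ _+_ (Σ≡sum f) (Σ≡sum g))))

*-distribˡ-Σ : ∀ c (f : Fin n → ℚ) → c * Σ[< n ] f ≡ Σ[< n ] (λ i → c * f i)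
*-distribˡ-Σ {n} c f =
  trans (cong (c *_) (Σ≡sum f)) (trans (ℚ-Sum.*-distribˡ-sum c f) (sym (Σ≡sum {n} _)))

Σ[c*f]≡c : ∀ c {f : Fin n → ℚ} → Σ[< n ] f ≡ 1ℚ → Σ[< n ] (λ i → c * f i) ≡ c
Σ[c*f]≡c c {f} Σf≡1 = trans (sym (*-distribˡ-Σ c f)) (trans (cong (c *_) Σf≡1) (ℚ.*-identityʳ c))

Σ-comm : ∀ {m} (f : Fin m → Fin n → ℚ) →
         Σ[< m ] (λ i → Σ[< n ] (f i)) ≡ Σ[< n ] (λ j → Σ[< m ] (λ i → f i j))
Σ-comm {n} {m} f = begin
  Σ[< m ] (λ i → Σ[< n ] (f i))               ≡⟨ Σ-cong (λ i → Σ≡sum (f i)) ⟩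
  Σ[< m ] (λ i → sum (f i))                   ≡⟨ Σ≡sum {m} _ ⟩
  sum (λ i → sum (f i))                       ≡⟨ ℚ-Sum.∑-comm f ⟩
  sum (λ j → sum (λ i → f i j))               ≡⟨ Σ≡sum {n} _ ⟨
  Σ[< n ] (λ j → sum (λ i → f i j))           ≡⟨ Σ-cong (λ j → Σ≡sum (λ i → f i j)) ⟨
  Σ[< n ] (λ j → Σ[< m ] (λ i → f i j))       ∎
  where open ≡-Reasoning

Σ-permute : ∀ (f : Fin n → ℚ) (σ : Permutation′ n) → Σ[< n ] f ≡ Σ[< n ] (λ i → f (σ ⟨$⟩ʳ i))
Σ-permute {n} f σ = trans (Σ≡sum f) (trans (ℚ-Sum.sum-permute f σ) (sym (Σ≡sum {n} _)))

ℕ→ℚ : ℕ → ℚ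
ℕ→ℚ zero    = 0ℚ
ℕ→ℚ (suc k) = 1ℚ + ℕ→ℚ k

ℕ→ℚ-<-suc : ∀ k → ℕ→ℚ k < ℕ→ℚ (suc k)
ℕ→ℚ-<-suc k = subst (_< ℕ→ℚ (suc k)) (ℚ.+-identityˡ (ℕ→ℚ k)) (ℚ.+-monoˡ-< (ℕ→ℚ k) (ℚ.positive⁻¹ 1ℚ))

ℕ→ℚ-mono-≤ : ∀ {a b} → a ℕ.≤ b → ℕ→ℚ a ≤ ℕ→ℚ b
ℕ→ℚ-mono-≤ {b = zero}  ℕ.z≤n       = ℚ.≤-refl
ℕ→ℚ-mono-≤ {b = suc b} ℕ.z≤n       = ℚ.≤-trans (ℕ→ℚ-mono-≤ {b = b} ℕ.z≤n) (ℚ.<⇒≤ (ℕ→ℚ-<-suc b))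
ℕ→ℚ-mono-≤             (ℕ.s≤s a≤b) = ℚ.+-monoʳ-≤ 1ℚ (ℕ→ℚ-mono-≤ a≤b)

ℕ→ℚ-cancel-≤ : ∀ {a b} → ℕ→ℚ a ≤ ℕ→ℚ b → a ℕ.≤ b
ℕ→ℚ-cancel-≤ {a} {b} a≤b = ℕ.≮⇒≥ λ b<a →
  ℚ.<-irrefl refl (ℚ.<-≤-trans (ℚ.<-≤-trans (ℕ→ℚ-<-suc b) (ℕ→ℚ-mono-≤ b<a)) a≤b)

indicator : Subset n → Fin n → ℚ
indicator S i = if does (i ∈? S) then 1ℚ else 0ℚ

Σ-indicator : ∀ (S : Subset n) → Σ[< n ] (indicator S) ≡ ℕ→ℚ ∣ S ∣
Σ-indicator []            = refl
Σ-indicator (inside  ∷ S) = cong (1ℚ +_) (Σ-indicator S)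
Σ-indicator (outside ∷ S) = trans (ℚ.+-identityˡ _) (Σ-indicator S)

UnitRowSums : Matrix n → Set
UnitRowSums {n} E = ∀ i → Σ[< n ] (E i) ≡ 1ℚ

UnitColumnSums : Matrix n → Set
UnitColumnSums {n} E = ∀ j → Σ[< n ] (λ i → E i j) ≡ 1ℚ

support : Matrix n → Graph n n
support E i = tabulate (λ j → not (does (E i j ≟ 0ℚ)))

∈-support⁺ : ∀ (E : Matrix n) {i j} → E i j ≢ 0ℚ → j ∈ support E i
∈-support⁺ E {i} {j} Eij≢0 =
  lookup⇒[]= j _ (trans (lookup∘tabulate _ j) (cong not (dec-false (E i j ≟ 0ℚ) Eij≢0)))

∈-support⁻ : ∀ (E : Matrix n) {i j} → j ∈ support E i → E i j ≢ 0ℚ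
∈-support⁻ E {i} {j} j∈Eᵢ with E i j ≟ 0ℚ | trans (sym (lookup∘tabulate _ j)) ([]=⇒lookup j∈Eᵢ)
... | no Eij≢0 | _  = Eij≢0
... | yes _    | ()

module _ {E : Matrix n} (nonneg : ∀ i j → 0ℚ ≤ E i j)
         (rows : UnitRowSums E) (cols : ∀ j → Σ[< n ] (λ i → E i j) ≤ 1ℚ) where

  indicator*≤ : ∀ S i j → indicator S i * E i j ≤ E i j
  indicator*≤ S i j with i ∈? S
  ... | yes _ = ℚ.≤-reflexive (ℚ.*-identityˡ (E i j))
  ... | no  _ = subst (_≤ E i j) (sym (ℚ.*-zeroˡ (E i j))) (nonneg i j)

  Σ-indicator*column≤ : ∀ S j → Σ[< n ] (λ i → indicator S i * E i j) ≤ indicator (Γ (support E) S) j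
  Σ-indicator*column≤ S j with j ∈? Γ (support E) S
  ... | yes _   = ℚ.≤-trans (Σ-mono-≤ (λ i → indicator*≤ S i j)) (cols j)
  ... | no j∉ΓS = ℚ.≤-reflexive (Σ-zero term≡0)
    where
    term≡0 : ∀ i → indicator S i * E i j ≡ 0ℚ
    term≡0 i with i ∈? S
    ... | no  _   = ℚ.*-zeroˡ (E i j)
    ... | yes i∈S = trans (ℚ.*-identityˡ (E i j))
      (decidable-stable (E i j ≟ 0ℚ) (λ Eij≢0 → j∉ΓS (Γ⁺ (support E) i∈S (∈-support⁺ E Eij≢0))))

  support-hallCondition : HallCondition (support E)
  support-hallCondition S = ℕ→ℚ-cancel-≤ (begin
    ℕ→ℚ ∣ S ∣                                                ≡⟨ Σ-indicator S ⟨
    Σ[< n ] (indicator S)                                    ≡⟨ Σ-cong (λ i → Σ[c*f]≡c {n} (indicator S i) (rows i)) ⟨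
    Σ[< n ] (λ i → Σ[< n ] (λ j → indicator S i * E i j))    ≡⟨ Σ-comm (λ i j → indicator S i * E i j) ⟩
    Σ[< n ] (λ j → Σ[< n ] (λ i → indicator S i * E i j))    ≤⟨ Σ-mono-≤ (Σ-indicator*column≤ S) ⟩
    Σ[< n ] (indicator (Γ (support E) S))                    ≡⟨ Σ-indicator (Γ (support E) S) ⟩
    ℕ→ℚ ∣ Γ (support E) S ∣                                  ∎)
    where open ℚ.≤-Reasoning

bistochastic⇒∃inner : ∀ {E : Matrix n} → Bistochastic E → ∃ (Inner E)
bistochastic⇒∃inner {E = E} (bounds , rows , cols)
  with hall (support E) (support-hallCondition (λ i j → proj₁ (bounds i j)) rows (ℚ.≤-reflexive ∘ cols))
... | f , f-injective , f∈support = injective⇒permutation f-injective , λ i → ∈-support⁻ E (f∈support i)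

sumOfSquares : Matrix n → ℚ
sumOfSquares {n} E = Σ[< n ] (λ i → Σ[< n ] (λ j → E i j * E i j))

Σ-E*[u+v]≡Σu+Σv : ∀ (E : Matrix n) (u v : Vector n) → UnitRowSums E → UnitColumnSums E →
                   Σ[< n ] (λ i → Σ[< n ] (λ j → E i j * (u i + v j))) ≡ Σ[< n ] u + Σ[< n ] v
Σ-E*[u+v]≡Σu+Σv {n} E u v rows cols = begin
  Σ[< n ] (λ i → Σ[< n ] (λ j → E i j * (u i + v j)))
    ≡⟨ Σ-cong (λ i → trans (Σ-cong (split i)) (Σ-distrib-+ (λ j → u i * E i j) (λ j → v j * E i j))) ⟩
  Σ[< n ] (λ i → Σ[< n ] (λ j → u i * E i j) + Σ[< n ] (λ j → v j * E i j))
    ≡⟨ Σ-distrib-+ (λ i → Σ[< n ] (λ j → u i * E i j)) (λ i → Σ[< n ] (λ j → v j * E i j)) ⟩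
  Σ[< n ] (λ i → Σ[< n ] (λ j → u i * E i j)) + Σ[< n ] (λ i → Σ[< n ] (λ j → v j * E i j))
    ≡⟨ cong (Σ[< n ] (λ i → Σ[< n ] (λ j → u i * E i j)) +_) (Σ-comm (λ i j → v j * E i j)) ⟩
  Σ[< n ] (λ i → Σ[< n ] (λ j → u i * E i j)) + Σ[< n ] (λ j → Σ[< n ] (λ i → v j * E i j))
    ≡⟨ cong₂ _+_ (Σ-cong (λ i → Σ[c*f]≡c {n} (u i) (rows i))) (Σ-cong (λ j → Σ[c*f]≡c {n} (v j) (cols j))) ⟩
  Σ[< n ] u + Σ[< n ] v
    ∎
  where
  open ≡-Reasoning
  split : ∀ i j → E i j * (u i + v j) ≡ u i * E i j + v j * E i j
  split i j = trans (ℚ.*-distribˡ-+ (E i j) (u i) (v j))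
                    (cong₂ _+_ (ℚ.*-comm (E i j) (u i)) (ℚ.*-comm (E i j) (v j)))

p+q≡r⇒[p≤r⇔0≤q] : ∀ {p q r} → p + q ≡ r → (p ≤ r ⇔ 0ℚ ≤ q)
p+q≡r⇒[p≤r⇔0≤q] {p} {q} refl = mk⇔
  (λ p≤p+q → ℚ.≮⇒≥ λ q<0 →
    ℚ.<-irrefl refl (ℚ.<-≤-trans (subst (p + q <_) (ℚ.+-identityʳ p) (ℚ.+-monoʳ-< p q<0)) p≤p+q))
  (λ 0≤q → subst (_≤ p + q) (ℚ.+-identityʳ p) (ℚ.+-monoʳ-≤ p 0≤q))

module _ (E : Matrix n) (u v : Vector n) (form : ∀ i j → E i j ≡ (u i + v j) * skel E i j) where

  outerTerm : Fin n → Fin n → ℚ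
  outerTerm i j = if does (E i j ≟ 0ℚ) then u i + v j else 0ℚ

  entry≡u+v : ∀ {i j} → E i j ≢ 0ℚ → E i j ≡ u i + v j
  entry≡u+v {i} {j} Eij≢0 = begin
    E i j                     ≡⟨ form i j ⟩
    (u i + v j) * skel E i j  ≡⟨ cong (λ b → (u i + v j) * (if b then 0ℚ else 1ℚ))
                                       (dec-false (E i j ≟ 0ℚ) Eij≢0) ⟩
    (u i + v j) * 1ℚ          ≡⟨ ℚ.*-identityʳ (u i + v j) ⟩
    u i + v j                 ∎
    where open ≡-Reasoning

  entry*entry≡entry*[u+v] : ∀ i j → E i j * E i j ≡ E i j * (u i + v j)
  entry*entry≡entry*[u+v] i j with E i j ≟ 0ℚ
  ... | yes Eij≡0 rewrite Eij≡0 = trans (ℚ.*-zeroˡ 0ℚ) (sym (ℚ.*-zeroˡ (u i + v j)))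
  ... | no  Eij≢0 = cong (E i j *_) (entry≡u+v Eij≢0)

  entry+outerTerm≡u+v : ∀ i j → E i j + outerTerm i j ≡ u i + v j
  entry+outerTerm≡u+v i j with E i j ≟ 0ℚ
  ... | yes Eij≡0 rewrite Eij≡0 = ℚ.+-identityˡ (u i + v j)
  ... | no  Eij≢0 = trans (ℚ.+-identityʳ (E i j)) (entry≡u+v Eij≢0)

  trace+outerSum≡Σu+Σv : ∀ σ → tr σ E + outerSum E u v σ ≡ Σ[< n ] u + Σ[< n ] v
  trace+outerSum≡Σu+Σv σ = begin
    tr σ E + outerSum E u v σ
      ≡⟨ Σ-distrib-+ (λ i → E i (σ ⟨$⟩ʳ i)) (λ i → outerTerm i (σ ⟨$⟩ʳ i)) ⟨
    Σ[< n ] (λ i → E i (σ ⟨$⟩ʳ i) + outerTerm i (σ ⟨$⟩ʳ i))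
      ≡⟨ Σ-cong (λ i → entry+outerTerm≡u+v i (σ ⟨$⟩ʳ i)) ⟩
    Σ[< n ] (λ i → u i + v (σ ⟨$⟩ʳ i))
      ≡⟨ Σ-distrib-+ u (λ i → v (σ ⟨$⟩ʳ i)) ⟩
    Σ[< n ] u + Σ[< n ] (λ i → v (σ ⟨$⟩ʳ i))
      ≡⟨ cong (Σ[< n ] u +_) (Σ-permute v σ) ⟨
    Σ[< n ] u + Σ[< n ] v
      ∎
    where open ≡-Reasoning

  trace+outerSum≡sumOfSquares : UnitRowSums E → UnitColumnSums E →
    ∀ σ → tr σ E + outerSum E u v σ ≡ sumOfSquares E
  trace+outerSum≡sumOfSquares rows cols σ = trans (trace+outerSum≡Σu+Σv σ) (sym (begin
    sumOfSquares E                                       ≡⟨ Σ-cong (λ i → Σ-cong (entry*entry≡entry*[u+v] i)) ⟩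
    Σ[< n ] (λ i → Σ[< n ] (λ j → E i j * (u i + v j)))  ≡⟨ Σ-E*[u+v]≡Σu+Σv E u v rows cols ⟩
    Σ[< n ] u + Σ[< n ] v                                ∎))
    where open ≡-Reasoning

  inner⇒outerSum≡0 : ∀ σ → Inner E σ → outerSum E u v σ ≡ 0ℚ
  inner⇒outerSum≡0 σ inner = Σ-zero λ i →
    cong (λ b → if b then u i + v (σ ⟨$⟩ʳ i) else 0ℚ) (dec-false (E i (σ ⟨$⟩ʳ i) ≟ 0ℚ) (inner i))

  outerSum-nonneg : (∀ σ → ¬ Inner E σ → 0ℚ ≤ outerSum E u v σ) → ∀ σ → 0ℚ ≤ outerSum E u v σ
  outerSum-nonneg outer≥0 σ with Fin.all? (λ i → ¬? (E i (σ ⟨$⟩ʳ i) ≟ 0ℚ))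
  ... | yes inner = ℚ.≤-reflexive (sym (inner⇒outerSum≡0 σ inner))
  ... | no ¬inner = outer≥0 σ ¬inner

  erdos⇔outerSum≥0 : UnitRowSums E → UnitColumnSums E → ∃ (Inner E) →
    Erdos E ⇔ (∀ σ → ¬ Inner E σ → 0ℚ ≤ outerSum E u v σ)
  erdos⇔outerSum≥0 rows cols (σ₀ , σ₀-inner) = mk⇔
    (λ (_ , trace≤) σ _ → Equivalence.to (trace≤⇔outerSum≥0 σ) (trace≤ σ))
    (λ outer≥0 → (σ₀ , traceσ₀)
               , λ σ → Equivalence.from (trace≤⇔outerSum≥0 σ) (outerSum-nonneg outer≥0 σ))
    where
    trace≤⇔outerSum≥0 : ∀ σ → tr σ E ≤ sumOfSquares E ⇔ 0ℚ ≤ outerSum E u v σ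
    trace≤⇔outerSum≥0 σ = p+q≡r⇒[p≤r⇔0≤q] (trace+outerSum≡sumOfSquares rows cols σ)
    traceσ₀ : tr σ₀ E ≡ sumOfSquares E
    traceσ₀ = begin
      tr σ₀ E                             ≡⟨ ℚ.+-identityʳ (tr σ₀ E) ⟨
      tr σ₀ E + 0ℚ                        ≡⟨ cong (tr σ₀ E +_) (inner⇒outerSum≡0 σ₀ σ₀-inner) ⟨
      tr σ₀ E + outerSum E u v σ₀         ≡⟨ trace+outerSum≡sumOfSquares rows cols σ₀ ⟩
      sumOfSquares E                      ∎
      where open ≡-Reasoning

lemma1p3 : (n : ℕ) (E : Matrix n) (u v : Vector n) →
    Bistochastic E → RCDS E →
    (∀ i j → E i j ≡ (u i + v j) * skel E i j) →
    Erdos E ⇔ (∀ (σ : Permutation′ n) → ¬ Inner E σ → 0ℚ ≤ outerSum E u v σ)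
lemma1p3 n E u v bistochastic@(_ , rows , cols) _ form =
  erdos⇔outerSum≥0 E u v form rows cols (bistochastic⇒∃inner bistochastic)
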